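{- Let $(\mathbf{C},\mathcal{M})$ satisfy the standing assumptions of the context. Consider $\mathcal{M}$-morphisms $a_1:A\to B_1$, $a_2:A\to B_2$ with pushout $B_1\xrightarrow{d_1}D\xleftarrow{d_2}B_2$, and $\mathcal{M}$-morphisms $e_1:B_1\to E$, $e_2:B_2\to E$ with $e_1\circ a_1=e_2\circ a_2$; let $e:D\to E$ be the induced morphism ($e\circ d_j=e_j$). Let $B_1\xleftarrow{b_1}X\xrightarrow{b_2}B_2$ be the pullback of $B_1\xrightarrow{e_1}E\xleftarrow{e_2}B_2$ and $x:A\to X$ the induced morphism. Then $e$ is an epimorphism if and only if the square formed by $b_1,b_2,e_1,e_2$ (with $e_1 b_1=e_2 b_2$) is a pushout.
   Context: Standing assumptions: $\mathbf{C}$ is a category and $\mathcal{M}$ a class of monomorphisms such that $(\mathbf{C},\mathcal{M})$ is $\mathcal{M}$-adhesive: $\mathcal{M}$ contains all isomorphisms and is closed under composition and decomposition ($g\circ f\in\mathcal{M}$ and $g\in\mathcal{M}$ imply $f\in\mathcal{M}$); pushouts of spans and pullbacks of cospans with at least one leg in $\mathcal{M}$ exist; $\mathcal{M}$ is stable under pushout and pullback; pushouts along $\mathcal{M}$-morphisms are $\mathcal{M}$-van Kampen squares (in a commutative cube whose bottom face is a pushout along an $\mathcal{M}$-morphism, whose back faces are pullbacks and whose vertical morphisms other than the one into the source corner of the bottom square are in $\mathcal{M}$, the top face is a pushout iff the front faces are pullbacks). Further, $\mathbf{C}$ has epi-$\mathcal{M}$-factorizations (every morphism is $m\circ e$ with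 $e$ epi, $m\in\mathcal{M}$, unique up to iso), is balanced (morphisms that are mono and epi are isos), has a strict $\mathcal{M}$-initial object (an object $\varnothing$ with a unique monomorphism $\varnothing\to A$, lying in $\mathcal{M}$, for every $A$, and such that every morphism $Y\to\varnothing$ is an iso), and has $\mathcal{M}$-effective unions: whenever $B\xleftarrow{b'}A\xrightarrow{c'}C$ are $\mathcal{M}$-morphisms with pushout $D$ and $b:B\to E$, $c:C\to E$ are $\mathcal{M}$-morphisms with $b b'=c c'$ forming a pullback square, the induced morphism $D\to E$ is in $\mathcal{M}$. -}

module Defs where

open import Level using (Level; _⊔_; suc)
open import Data.Product using (Σ; _×_; _,_; ∃)
open import Data.Sum using (_⊎_)
open import Relation.Binary.PropositionalEquality using (_≡_)

record Category (o ℓ : Level) : Set (suc (o ⊔ ℓ)) where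
  infixr 9 _∘_
  field
    Obj : Set o
    Hom : Obj → Obj → Set ℓ
    id  : ∀ {A} → Hom A A
    _∘_ : ∀ {A B C} → Hom B C → Hom A B → Hom A C
    assoc : ∀ {A B C D} (h : Hom C D) (g : Hom B C) (f : Hom A B) →
            (h ∘ g) ∘ f ≡ h ∘ (g ∘ f)
    identityˡ : ∀ {A B} (f : Hom A B) → id ∘ f ≡ f
    identityʳ : ∀ {A B} (f : Hom A B) → f ∘ id ≡ f

module Notions {o ℓ : Level} (𝐂 : Category o ℓ) where
  open Category 𝐂

  Mono : ∀ {A B} → Hom A B → Set (o ⊔ ℓ)
  Mono {A} f = ∀ {Z} (g h : Hom Z A) → f ∘ g ≡ f ∘ h → g ≡ h

  Epi : ∀ {A B} → Hom A B → Set (o ⊔ ℓ)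
  Epi {B = B} f = ∀ {Z} (g h : Hom B Z) → g ∘ f ≡ h ∘ f → g ≡ h

  Iso : ∀ {A B} → Hom A B → Set ℓ
  Iso {A} {B} f = Σ (Hom B A) λ g → (g ∘ f ≡ id) × (f ∘ g ≡ id)

  -- Square        f
  --          A ------> B
  --        g |         | i
  --          v         v
  --          C ------> D
  --               j
  record IsPushout {A B C D : Obj} (f : Hom A B) (g : Hom A C)
                   (i : Hom B D) (j : Hom C D) : Set (o ⊔ ℓ) where
    field
      commute : i ∘ f ≡ j ∘ g
      universal : ∀ {Q} (p : Hom B Q) (q : Hom C Q) → p ∘ f ≡ q ∘ g →
                  Σ (Hom D Q) λ u → (u ∘ i ≡ p) × (u ∘ j ≡ q) ×
                    (∀ (u' : Hom D Q) → u' ∘ i ≡ p → u' ∘ j ≡ q → u' ≡ u)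

  -- Same square shape: (A, f, g) is a pullback of the cospan B -i-> D <-j- C.
  record IsPullback {A B C D : Obj} (f : Hom A B) (g : Hom A C)
                    (i : Hom B D) (j : Hom C D) : Set (o ⊔ ℓ) where
    field
      commute : i ∘ f ≡ j ∘ g
      universal : ∀ {Q} (p : Hom Q B) (q : Hom Q C) → i ∘ p ≡ j ∘ q →
                  Σ (Hom Q A) λ u → (f ∘ u ≡ p) × (g ∘ u ≡ q) ×
                    (∀ (u' : Hom Q A) → f ∘ u' ≡ p → g ∘ u' ≡ q → u' ≡ u)

record MAdhesiveSetting (o ℓ m : Level) : Set (suc (o ⊔ ℓ ⊔ m)) where
  field
    𝐂 : Category o ℓ
  open Category 𝐂
  open Notions 𝐂
  field
    M : ∀ {A B} → Hom A B → Set m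
    M-mono : ∀ {A B} {f : Hom A B} → M f → Mono f
    M-iso : ∀ {A B} {f : Hom A B} → Iso f → M f
    M-comp : ∀ {A B C} {f : Hom A B} {g : Hom B C} → M f → M g → M (g ∘ f)
    M-decomp : ∀ {A B C} {f : Hom A B} {g : Hom B C} → M (g ∘ f) → M g → M f
    pushout : ∀ {A B C} (f : Hom A B) (g : Hom A C) → M f ⊎ M g →
              Σ Obj λ D → Σ (Hom B D) λ i → Σ (Hom C D) λ j → IsPushout f g i j
    pullback : ∀ {B C D} (i : Hom B D) (j : Hom C D) → M i ⊎ M j →
               Σ Obj λ A → Σ (Hom A B) λ f → Σ (Hom A C) λ g → IsPullback f g i j
    M-pushout-stable : ∀ {A B C D} {f : Hom A B} {g : Hom A C} {i : Hom B D}
                       {j : Hom C D} → IsPushout f g i j → M f → M j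
    M-pullback-stable : ∀ {A B C D} {f : Hom A B} {g : Hom A C} {i : Hom B D}
                        {j : Hom C D} → IsPullback f g i j → M i → M g
    -- pushouts along M-morphisms are M-van Kampen squares.
    -- Bottom face: A -m-> B, A -f-> C, B -g-> D, C -n-> D, pushout, m ∈ M.
    -- Top face: A' -m'-> B', A' -f'-> C', B' -g'-> D', C' -n'-> D'.
    -- Vertical: a : A' → A, b : B' → B, c : C' → C, d : D' → D, with b, c, d ∈ M.
    -- Back faces (pullbacks): (m', a) over (b, m), (f', a) over (c, f).
    -- Front faces: (g', b) over (d, g), (n', c) over (d, n).
    van-Kampen :
      ∀ {A B C D A' B' C' D'}
        {m : Hom A B} {f : Hom A C} {g : Hom B D} {n : Hom C D}
        {m' : Hom A' B'} {f' : Hom A' C'} {g' : Hom B' D'} {n' : Hom C' D'}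
        {a : Hom A' A} {b : Hom B' B} {c : Hom C' C} {d : Hom D' D} →
      IsPushout m f g n → M m →
      g' ∘ m' ≡ n' ∘ f' →
      g ∘ b ≡ d ∘ g' → n ∘ c ≡ d ∘ n' →
      IsPullback m' a b m → IsPullback f' a c f →
      M b → M c → M d →
      (IsPushout m' f' g' n' → IsPullback g' b d g × IsPullback n' c d n) ×
      (IsPullback g' b d g × IsPullback n' c d n → IsPushout m' f' g' n')
    factor : ∀ {A B} (f : Hom A B) →
             Σ Obj λ I → Σ (Hom A I) λ e → Σ (Hom I B) λ m' →
               Epi e × M m' × (f ≡ m' ∘ e)
    factor-unique : ∀ {A B I J} {e : Hom A I} {m' : Hom I B}
                    {e' : Hom A J} {m'' : Hom J B} →
                    Epi e → M m' → Epi e' → M m'' → m' ∘ e ≡ m'' ∘ e' →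
                    Σ (Hom I J) λ i → Iso i × (i ∘ e ≡ e') × (m'' ∘ i ≡ m')
    balanced : ∀ {A B} {f : Hom A B} → Mono f → Epi f → Iso f
    ∅ : Obj
    ∅-mono : ∀ A → Σ (Hom ∅ A) λ i → Mono i × M i ×
                     (∀ (j : Hom ∅ A) → Mono j → j ≡ i)
    ∅-strict : ∀ {Y} (h : Hom Y ∅) → Iso h
    effective-unions :
      ∀ {A B C D E} {b' : Hom A B} {c' : Hom A C} {i : Hom B D} {j : Hom C D}
        {b : Hom B E} {c : Hom C E} →
      M b' → M c' → IsPushout b' c' i j →
      M b → M c → IsPullback b' c' b c →
      ∀ (u : Hom D E) → u ∘ i ≡ b → u ∘ j ≡ c → M u

-- The pullback X of e₁, e₂ has its legs in M, so by M-effective unions the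
-- comparison u : P → E out of the pushout P of the span B₁ ← X → B₂ is in M,
-- hence mono. Since the span a₁, a₂ factors through it via x, the pushout D
-- maps into P and e = u ∘ v. So if e is epi then so is u; by balancedness u
-- is an iso and the square (e₁, e₂) is a pushout. Conversely, the legs of a
-- pushout are jointly epic, and e₁, e₂ both factor through e.
module Submission where

open import Defs
open import Level using (Level; _⊔_)
open import Data.Product using (_×_; _,_)
open import Data.Sum using (inj₁)
open import Relation.Binary.PropositionalEquality
  using (_≡_; refl; sym; trans; cong; subst; module ≡-Reasoning)

module CategoryLemmas {o ℓ : Level} (𝐂 : Category o ℓ) where
  open Category 𝐂
  open Notions 𝐂
  open ≡-Reasoning

  JointlyEpi : ∀ {B C D} → Hom B D → Hom C D → Set (o ⊔ ℓ)
  JointlyEpi {D = D} i j =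
    ∀ {Z} (g h : Hom D Z) → g ∘ i ≡ h ∘ i → g ∘ j ≡ h ∘ j → g ≡ h

  ∘-pushˡ : ∀ {A B C D} {f : Hom A B} {g : Hom B C} {h : Hom A C} (k : Hom C D) →
            g ∘ f ≡ h → (k ∘ g) ∘ f ≡ k ∘ h
  ∘-pushˡ {f = f} {g} k gf≡h = trans (assoc k g f) (cong (k ∘_) gf≡h)

  cocone-restrict : ∀ {A X B₁ B₂ P} {a₁ : Hom A B₁} {a₂ : Hom A B₂}
                    {b₁ : Hom X B₁} {b₂ : Hom X B₂} {p₁ : Hom B₁ P} {p₂ : Hom B₂ P}
                    (x : Hom A X) → b₁ ∘ x ≡ a₁ → b₂ ∘ x ≡ a₂ →
                    p₁ ∘ b₁ ≡ p₂ ∘ b₂ → p₁ ∘ a₁ ≡ p₂ ∘ a₂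
  cocone-restrict {p₁ = p₁} {p₂} x b₁x≡a₁ b₂x≡a₂ p₁b₁≡p₂b₂ =
    trans (sym (∘-pushˡ p₁ b₁x≡a₁)) (trans (cong (_∘ x) p₁b₁≡p₂b₂) (∘-pushˡ p₂ b₂x≡a₂))

  IsPullback-swap : ∀ {A B C D} {f : Hom A B} {g : Hom A C} {i : Hom B D} {j : Hom C D} →
                    IsPullback f g i j → IsPullback g f j i
  IsPullback-swap pb = record
    { commute = sym (IsPullback.commute pb)
    ; universal = λ p q eq →
        let (u , fu , gu , unique) = IsPullback.universal pb q p (sym eq)
        in u , gu , fu , λ u' gu' fu' → unique u' fu' gu' }

  IsPushout⇒JointlyEpi : ∀ {A B C D} {f : Hom A B} {g : Hom A C} {i : Hom B D} {j : Hom C D} →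
                         IsPushout f g i j → JointlyEpi i j
  IsPushout⇒JointlyEpi {f = f} {g} {i} {j} po k h ki≡hi kj≡hj =
    let (_ , _ , _ , unique) = IsPushout.universal po (k ∘ i) (k ∘ j) k-cocone
    in trans (unique k refl refl) (sym (unique h (sym ki≡hi) (sym kj≡hj)))
    where
    k-cocone : (k ∘ i) ∘ f ≡ (k ∘ j) ∘ g
    k-cocone = trans (∘-pushˡ k (IsPushout.commute po)) (sym (assoc k j g))

  JointlyEpi-factor⇒Epi : ∀ {B C D E} {i : Hom B E} {j : Hom C E}
                          {e : Hom D E} {d₁ : Hom B D} {d₂ : Hom C D} →
                          JointlyEpi i j → e ∘ d₁ ≡ i → e ∘ d₂ ≡ j → Epi e
  JointlyEpi-factor⇒Epi {e = e} joint ed₁≡i ed₂≡j g h ge≡he =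
    joint g h (through ed₁≡i) (through ed₂≡j)
    where
    through : ∀ {Y} {d : Hom Y _} {k : Hom Y _} → e ∘ d ≡ k → g ∘ k ≡ h ∘ k
    through {d = d} {k} ed≡k = begin
      g ∘ k        ≡⟨ sym (∘-pushˡ g ed≡k) ⟩
      (g ∘ e) ∘ d  ≡⟨ cong (_∘ d) ge≡he ⟩
      (h ∘ e) ∘ d  ≡⟨ ∘-pushˡ h ed≡k ⟩
      h ∘ k        ∎

  Epi-∘⇒Epiˡ : ∀ {A B C} {u : Hom B C} {v : Hom A B} → Epi (u ∘ v) → Epi u
  Epi-∘⇒Epiˡ {u = u} {v} epi g h gu≡hu =
    epi g h (trans (sym (assoc g u v)) (trans (cong (_∘ v) gu≡hu) (assoc h u v)))

  IsPushout-transport-Iso :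
    ∀ {A B C D E} {f : Hom A B} {g : Hom A C} {i : Hom B D} {j : Hom C D}
      {i' : Hom B E} {j' : Hom C E} →
    IsPushout f g i j → (u : Hom D E) → Iso u → u ∘ i ≡ i' → u ∘ j ≡ j' →
    IsPushout f g i' j'
  IsPushout-transport-Iso {D = D} {E} {f} {g} {i} {j} {i'} {j'} po u (u⁻¹ , u⁻¹u≡id , uu⁻¹≡id) ui≡i' uj≡j' =
    record
    { commute = begin
        i' ∘ f       ≡⟨ cong (_∘ f) (sym ui≡i') ⟩
        (u ∘ i) ∘ f  ≡⟨ ∘-pushˡ u (IsPushout.commute po) ⟩
        u ∘ (j ∘ g)  ≡⟨ sym (assoc u j g) ⟩
        (u ∘ j) ∘ g  ≡⟨ cong (_∘ g) uj≡j' ⟩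
        j' ∘ g       ∎
    ; universal = λ p q cocone →
        let (w , wi≡p , wj≡q , unique) = IsPushout.universal po p q cocone
        in w ∘ u⁻¹
         , trans (through-u ui≡i' w) wi≡p
         , trans (through-u uj≡j' w) wj≡q
         , λ w' w'i'≡p w'j'≡q → begin
             w'                ≡⟨ sym (identityʳ w') ⟩
             w' ∘ id           ≡⟨ cong (w' ∘_) (sym uu⁻¹≡id) ⟩
             w' ∘ (u ∘ u⁻¹)    ≡⟨ sym (assoc w' u u⁻¹) ⟩
             (w' ∘ u) ∘ u⁻¹    ≡⟨ cong (_∘ u⁻¹) (unique (w' ∘ u)
                                    (trans (∘-pushˡ w' ui≡i') w'i'≡p)
                                    (trans (∘-pushˡ w' uj≡j') w'j'≡q)) ⟩
             w ∘ u⁻¹           ∎ }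
    where
    through-u : ∀ {Y Z} {k : Hom Y D} {k' : Hom Y E} → u ∘ k ≡ k' →
                (w : Hom D Z) → (w ∘ u⁻¹) ∘ k' ≡ w ∘ k
    through-u {k = k} {k'} uk≡k' w = begin
      (w ∘ u⁻¹) ∘ k'       ≡⟨ cong ((w ∘ u⁻¹) ∘_) (sym uk≡k') ⟩
      (w ∘ u⁻¹) ∘ (u ∘ k)  ≡⟨ assoc w u⁻¹ (u ∘ k) ⟩
      w ∘ (u⁻¹ ∘ (u ∘ k))  ≡⟨ cong (w ∘_) (sym (assoc u⁻¹ u k)) ⟩
      w ∘ ((u⁻¹ ∘ u) ∘ k)  ≡⟨ cong (λ t → w ∘ (t ∘ k)) u⁻¹u≡id ⟩
      w ∘ (id ∘ k)         ≡⟨ cong (w ∘_) (identityˡ k) ⟩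
      w ∘ k                ∎

module MAdhesiveLemmas {o ℓ m : Level} (S : MAdhesiveSetting o ℓ m) where
  open MAdhesiveSetting S
  open Category 𝐂
  open Notions 𝐂
  open CategoryLemmas 𝐂

  IsPullback-legs-M : ∀ {X B₁ B₂ E} {b₁ : Hom X B₁} {b₂ : Hom X B₂}
                      {e₁ : Hom B₁ E} {e₂ : Hom B₂ E} →
                      IsPullback b₁ b₂ e₁ e₂ → M e₁ → M e₂ → M b₁ × M b₂
  IsPullback-legs-M pb Me₁ Me₂ =
    M-pullback-stable (IsPullback-swap pb) Me₂ , M-pullback-stable pb Me₁

  effective-union-comparison-M :
    ∀ {X B₁ B₂ P E} {b₁ : Hom X B₁} {b₂ : Hom X B₂} {p₁ : Hom B₁ P} {p₂ : Hom B₂ P}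
      {e₁ : Hom B₁ E} {e₂ : Hom B₂ E} →
    M e₁ → M e₂ → IsPullback b₁ b₂ e₁ e₂ → IsPushout b₁ b₂ p₁ p₂ →
    (u : Hom P E) → u ∘ p₁ ≡ e₁ → u ∘ p₂ ≡ e₂ → M u
  effective-union-comparison-M Me₁ Me₂ pb po =
    let (Mb₁ , Mb₂) = IsPullback-legs-M pb Me₁ Me₂
    in effective-unions Mb₁ Mb₂ po Me₁ Me₂ pb

  Epi⇒IsPushout :
    ∀ {A B₁ B₂ D E X} {a₁ : Hom A B₁} {a₂ : Hom A B₂} {d₁ : Hom B₁ D} {d₂ : Hom B₂ D}
      {e₁ : Hom B₁ E} {e₂ : Hom B₂ E} {e : Hom D E} {b₁ : Hom X B₁} {b₂ : Hom X B₂} →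
    M e₁ → M e₂ → IsPullback b₁ b₂ e₁ e₂ → IsPushout a₁ a₂ d₁ d₂ →
    (x : Hom A X) → b₁ ∘ x ≡ a₁ → b₂ ∘ x ≡ a₂ →
    e ∘ d₁ ≡ e₁ → e ∘ d₂ ≡ e₂ → Epi e → IsPushout b₁ b₂ e₁ e₂
  Epi⇒IsPushout {e₁ = e₁} {e₂} {e} {b₁} {b₂} Me₁ Me₂ pb pod x b₁x≡a₁ b₂x≡a₂ ed₁≡e₁ ed₂≡e₂ epi =
    let (Mb₁ , _) = IsPullback-legs-M pb Me₁ Me₂
        (P , p₁ , p₂ , pob) = pushout b₁ b₂ (inj₁ Mb₁)
        (u , up₁≡e₁ , up₂≡e₂ , _) = IsPushout.universal pob e₁ e₂ (IsPullback.commute pb)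
        (v , vd₁≡p₁ , vd₂≡p₂ , _) = IsPushout.universal pod p₁ p₂
                                      (cocone-restrict x b₁x≡a₁ b₂x≡a₂ (IsPushout.commute pob))
        uv≡e : u ∘ v ≡ e
        uv≡e = IsPushout⇒JointlyEpi pod (u ∘ v) e
                 (trans (∘-pushˡ u vd₁≡p₁) (trans up₁≡e₁ (sym ed₁≡e₁)))
                 (trans (∘-pushˡ u vd₂≡p₂) (trans up₂≡e₂ (sym ed₂≡e₂)))
        Mu = effective-union-comparison-M Me₁ Me₂ pb pob u up₁≡e₁ up₂≡e₂
        epi-u = Epi-∘⇒Epiˡ (subst Epi (sym uv≡e) epi)
    in IsPushout-transport-Iso pob u (balanced (M-mono Mu) epi-u) up₁≡e₁ up₂≡e₂

theorem3p4 : ∀ {o ℓ m : Level} (S : MAdhesiveSetting o ℓ m) →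
    let open MAdhesiveSetting S
        open Category 𝐂
        open Notions 𝐂
    in
    ∀ {A B₁ B₂ D E X : Obj}
      (a₁ : Hom A B₁) (a₂ : Hom A B₂) → M a₁ → M a₂ →
      (d₁ : Hom B₁ D) (d₂ : Hom B₂ D) → IsPushout a₁ a₂ d₁ d₂ →
      (e₁ : Hom B₁ E) (e₂ : Hom B₂ E) → M e₁ → M e₂ → e₁ ∘ a₁ ≡ e₂ ∘ a₂ →
      (e : Hom D E) → e ∘ d₁ ≡ e₁ → e ∘ d₂ ≡ e₂ →
      (b₁ : Hom X B₁) (b₂ : Hom X B₂) → IsPullback b₁ b₂ e₁ e₂ →
      (x : Hom A X) → b₁ ∘ x ≡ a₁ → b₂ ∘ x ≡ a₂ →
      (Epi e → IsPushout b₁ b₂ e₁ e₂) × (IsPushout b₁ b₂ e₁ e₂ → Epi e)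
theorem3p4 S _ _ _ _ _ _ pod _ _ Me₁ Me₂ _ _ ed₁≡e₁ ed₂≡e₂ _ _ pb x b₁x≡a₁ b₂x≡a₂ =
  Epi⇒IsPushout Me₁ Me₂ pb pod x b₁x≡a₁ b₂x≡a₂ ed₁≡e₁ ed₂≡e₂ ,
  λ po → JointlyEpi-factor⇒Epi (IsPushout⇒JointlyEpi po) ed₁≡e₁ ed₂≡e₂
  where
  open MAdhesiveLemmas S
  open CategoryLemmas (MAdhesiveSetting.𝐂 S)
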